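{- Let $G$ be a finite, simple, undirected, connected graph that is $C_4$-free (i.e., $G$ contains no cycle of length four as a not necessarily induced subgraph), has order $n$, diameter $d$, and edge-connectivity at least $3$. Then $$d \leq \frac{2n-3}{5}.$$
   Context: The edge-connectivity of a graph is the minimum number of edges whose removal disconnects it. -}

module Defs where

open import Data.Nat using (ℕ; zero; suc; _≤_; _<_; _+_)
open import Data.Fin using (Fin)
open import Data.Bool using (Bool; true; false; _∧_; not)
open import Data.Product using (Σ; _×_; ∃; ∃-syntax)
open import Relation.Binary.PropositionalEquality using (_≡_; _≢_)
open import Relation.Nullary using (¬_)

record Graph (n : ℕ) : Set where
  field
    adj   : Fin n → Fin n → Bool
    sym   : ∀ u v → adj u v ≡ adj v u
    irrefl : ∀ v → adj v v ≡ false
open Graph public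

Adj : ∀ {n} → Graph n → Fin n → Fin n → Set
Adj G u v = adj G u v ≡ true

data Walk {n : ℕ} (A : Fin n → Fin n → Bool) : Fin n → Fin n → ℕ → Set where
  [] : ∀ {v} → Walk A v v zero
  step : ∀ {u w v k} → A u w ≡ true → Walk A w v k → Walk A u v (suc k)

DistLe : ∀ {n} → Graph n → Fin n → Fin n → ℕ → Set
DistLe G u v k = Σ ℕ λ m → (m ≤ k) × Walk (adj G) u v m

ConnectedRel : ∀ {n} → (Fin n → Fin n → Bool) → Set
ConnectedRel {n} A = ∀ (u v : Fin n) → Σ ℕ λ m → Walk A u v m

Connected : ∀ {n} → Graph n → Set
Connected G = ConnectedRel (adj G)

IsDiameter : ∀ {n} → Graph n → ℕ → Set
IsDiameter {n} G d =
  (∀ (u v : Fin n) → DistLe G u v d) ×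
  (Σ (Fin n) λ u → Σ (Fin n) λ v → ∀ m → m < d → ¬ Walk (adj G) u v m)

C4Free : ∀ {n} → Graph n → Set
C4Free {n} G = ∀ (a b c e : Fin n) →
  a ≢ b → a ≢ c → a ≢ e → b ≢ c → b ≢ e → c ≢ e →
  ¬ (Adj G a b × Adj G b c × Adj G c e × Adj G e a)

open import Data.Fin using (_≟_)
open import Relation.Nullary.Decidable using (⌊_⌋)

samePair : ∀ {n} → Fin n → Fin n → Fin n → Fin n → Bool
samePair u v x y =
  (⌊ u ≟ x ⌋ ∧ ⌊ v ≟ y ⌋) Data.Bool.∨ (⌊ u ≟ y ⌋ ∧ ⌊ v ≟ x ⌋)

-- Adjacency after deleting the (at most two) edges {x₁,y₁} and {x₂,y₂}
-- (deleting a non-edge has no effect; taking both pairs equal deletes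
-- only one edge).
delete2 : ∀ {n} → Graph n → Fin n → Fin n → Fin n → Fin n → Fin n → Fin n → Bool
delete2 G x₁ y₁ x₂ y₂ u v =
  adj G u v ∧ not (samePair u v x₁ y₁) ∧ not (samePair u v x₂ y₂)

-- Edge-connectivity at least 3: G has at least two vertices (the trivial
-- graph K₁ has edge-connectivity 0 by convention) and deleting any set of
-- at most two edges leaves the graph connected.
EdgeConnAtLeast3 : ∀ {n} → Graph n → Set
EdgeConnAtLeast3 {n} G =
  (2 ≤ n) × (∀ (x₁ y₁ x₂ y₂ : Fin n) → ConnectedRel (delete2 G x₁ y₁ x₂ y₂))

-- Fix a vertex u of eccentricity d and split the vertices into the distance layers
-- N₀, …, N_d from u.  Edge-connectivity 3 puts three distinct edges across every cut,
-- in particular between N_i and N_{i+1}, and gives every vertex three neighbours;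
-- C₄-freeness forbids two vertices from having two common neighbours.  Together they
-- exclude a few patterns of small consecutive layers: sizes (1,≤2), (≤2,1), (≤2,*,1),
-- (1,*,≤2), (≤2,≤2,≤2), (≤3,≤3,1), (≤3,≤2,≤2,≤3), and (≤2,≤2) at the far end.
-- A potential on the last three layer sizes (capped at 4) shows that every sequence
-- avoiding these patterns has 2 (s₀ + ⋯ + s_d) ≥ 5 d + 3, while the s_i sum to at most n.
module Submission where

open import Defs renaming (sym to adj-sym; irrefl to adj-irrefl)
open import Data.Bool using (Bool; true; false; T; _∧_; _∨_; not)
open import Data.Bool.Properties using (∨-zeroʳ)
open import Data.Empty using (⊥; ⊥-elim)
open import Data.Fin using (Fin; _≟_) renaming (zero to fzero; suc to fsuc)
open import Data.List using (List; []; _∷_; length; filterᵇ; allFin)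
open import Data.List.Membership.Propositional using (_∈_)
open import Data.List.Membership.Propositional.Properties using (∈-filter⁺; ∈-allFin)
open import Data.List.Properties using (length-filter; length-tabulate)
open import Data.List.Relation.Unary.Any using (here; there)
open import Data.Nat using (ℕ; zero; suc; _≤_; _<_; _+_; _*_; _∸_; _⊓_; z≤n; s≤s; _≤?_)
open import Data.Nat.Properties
  using ( ≤-refl; ≤-trans; ≤-reflexive; ≤-antisym; ≤-pred; n≤1+n; <-cmp; 1+n≰n; ≤-<-trans
        ; m≤n⇒m<n∨m≡n; ≰⇒>; m+[n∸m]≡n; +-suc; +-identityʳ; +-assoc; *-distribˡ-+
        ; +-mono-≤; +-monoˡ-≤; +-monoʳ-≤; *-monoʳ-≤; m⊓n≤m; m⊓n≤n; ⊓-glb; ⊓-sel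
        ; module ≤-Reasoning )
open import Data.Nat.Tactic.RingSolver using (solve-∀)
open import Data.Product using (Σ; _×_; _,_; proj₁; proj₂)
open import Data.Product.Properties using (,-injective; ×-≡,≡→≡)
open import Data.Sum using (_⊎_; inj₁; inj₂)
open import Data.Unit using (tt)
open import Function using (_∘_; id)
open import Relation.Binary using (tri<; tri≈; tri>)
open import Relation.Binary.Definitions using (DecidableEquality)
open import Relation.Binary.PropositionalEquality using (_≡_; _≢_; refl; sym; trans; cong; subst)
open import Relation.Nullary using (¬_; Dec; yes; no)
open import Relation.Nullary.Decidable using (⌊_⌋; T?; toWitness; ¬?; _×-dec_; _⊎-dec_; _→-dec_)

-- Sequences of layer sizes

Forbidden₂ : ℕ → ℕ → Set
Forbidden₂ a b = (a ≤ 1 × b ≤ 2) ⊎ (a ≤ 2 × b ≤ 1)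

Forbidden₃ : ℕ → ℕ → ℕ → Set
Forbidden₃ a b c = (a ≤ 2 × c ≤ 1) ⊎ (a ≤ 1 × c ≤ 2) ⊎ (a ≤ 2 × b ≤ 2 × c ≤ 2) ⊎ (a ≤ 3 × b ≤ 3 × c ≤ 1)

Forbidden₄ : ℕ → ℕ → ℕ → ℕ → Set
Forbidden₄ a b c e = a ≤ 3 × b ≤ 2 × c ≤ 2 × e ≤ 3

ForbiddenEnd : ℕ → ℕ → Set
ForbiddenEnd a b = a ≤ 2 × b ≤ 2

forbidden₂? : ∀ a b → Dec (Forbidden₂ a b)
forbidden₂? a b = (a ≤? 1 ×-dec b ≤? 2) ⊎-dec (a ≤? 2 ×-dec b ≤? 1)

forbidden₃? : ∀ a b c → Dec (Forbidden₃ a b c)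
forbidden₃? a b c =
  (a ≤? 2 ×-dec c ≤? 1) ⊎-dec (a ≤? 1 ×-dec c ≤? 2) ⊎-dec
  (a ≤? 2 ×-dec b ≤? 2 ×-dec c ≤? 2) ⊎-dec (a ≤? 3 ×-dec b ≤? 3 ×-dec c ≤? 1)

forbidden₄? : ∀ a b c e → Dec (Forbidden₄ a b c e)
forbidden₄? a b c e = a ≤? 3 ×-dec b ≤? 2 ×-dec c ≤? 2 ×-dec e ≤? 3

forbiddenEnd? : ∀ a b → Dec (ForbiddenEnd a b)
forbiddenEnd? a b = a ≤? 2 ×-dec b ≤? 2

Size : ℕ → Set
Size a = 1 ≤ a × a ≤ 4

Admissible₃ : ℕ → ℕ → ℕ → Set
Admissible₃ a b c = ¬ Forbidden₂ a b × ¬ Forbidden₂ b c × ¬ Forbidden₃ a b c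

admissible₃? : ∀ a b c → Dec (Admissible₃ a b c)
admissible₃? a b c = ¬? (forbidden₂? a b) ×-dec ¬? (forbidden₂? b c) ×-dec ¬? (forbidden₃? a b c)

record Admissible (d : ℕ) (s : ℕ → ℕ) : Set where
  field
    sizes      : ∀ i → i ≤ d → Size (s i)
    no-window₂ : ∀ i → 1 + i ≤ d → ¬ Forbidden₂ (s i) (s (1 + i))
    no-window₃ : ∀ i → 2 + i ≤ d → ¬ Forbidden₃ (s i) (s (1 + i)) (s (2 + i))
    no-window₄ : ∀ i → 3 + i ≤ d → ¬ Forbidden₄ (s i) (s (1 + i)) (s (2 + i)) (s (3 + i))
    no-end     : ∀ i → 1 + i ≡ d → ¬ ForbiddenEnd (s i) (s (1 + i))

partialSum : (ℕ → ℕ) → ℕ → ℕ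
partialSum s zero    = s zero
partialSum s (suc k) = partialSum s k + s (suc k)

partialSum-mono : ∀ {f g : ℕ → ℕ} → (∀ i → f i ≤ g i) → ∀ k → partialSum f k ≤ partialSum g k
partialSum-mono f≤g zero    = f≤g zero
partialSum-mono f≤g (suc k) = +-mono-≤ (partialSum-mono f≤g k) (f≤g (suc k))

-- potential a b c is the least value of 2 (s₀ + ⋯ + s_k) − 5 k over admissible
-- s₀ … s_k ending in a b c, found by exhaustive search; the triples not listed
-- contain a forbidden window.
potential : ℕ → ℕ → ℕ → ℕ
potential 1 3 3 = 4
potential 1 3 4 = 6
potential 1 4 3 = 6
potential 1 4 4 = 8
potential 2 2 3 = 4
potential 2 2 4 = 5
potential 2 3 2 = 3
potential 2 3 3 = 5
potential 2 3 4 = 7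
potential 2 4 2 = 4
potential 2 4 3 = 6
potential 2 4 4 = 8
potential 3 1 3 = 4
potential 3 1 4 = 6
potential 3 2 2 = 2
potential 3 2 3 = 4
potential 3 2 4 = 6
potential 3 3 2 = 3
potential 3 3 3 = 5
potential 3 3 4 = 7
potential 3 4 1 = 3
potential 3 4 2 = 5
potential 3 4 3 = 7
potential 3 4 4 = 9
potential 4 1 3 = 4
potential 4 1 4 = 6
potential 4 2 2 = 3
potential 4 2 3 = 5
potential 4 2 4 = 7
potential 4 3 1 = 3
potential 4 3 2 = 5
potential 4 3 3 = 7
potential 4 3 4 = 9
potential 4 4 1 = 5
potential 4 4 2 = 7
potential 4 4 3 = 9
potential 4 4 4 = 11
potential _ _ _ = 0

T-∧-split : ∀ x {y} → T (x ∧ y) → T x × T y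
T-∧-split true t = _ , t

forSizes : (ℕ → Bool) → Bool
forSizes p = p 1 ∧ p 2 ∧ p 3 ∧ p 4

forSizes-sound : ∀ p → T (forSizes p) → ∀ {a} → Size a → T (p a)
forSizes-sound p t {1} _ = proj₁ (T-∧-split (p 1) t)
forSizes-sound p t {2} _ = proj₁ (T-∧-split (p 2) (proj₂ (T-∧-split (p 1) t)))
forSizes-sound p t {3} _ = proj₁ (T-∧-split (p 3) (proj₂ (T-∧-split (p 2) (proj₂ (T-∧-split (p 1) t)))))
forSizes-sound p t {4} _ = proj₂ (T-∧-split (p 3) (proj₂ (T-∧-split (p 2) (proj₂ (T-∧-split (p 1) t)))))
forSizes-sound p t {suc (suc (suc (suc (suc _))))} (_ , s≤s (s≤s (s≤s (s≤s ()))))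

forSizes²-sound : ∀ (p : ℕ → ℕ → Bool) → T (forSizes λ a → forSizes λ b → p a b) →
  ∀ {a b} → Size a → Size b → T (p a b)
forSizes²-sound p t sa sb = forSizes-sound (p _) (forSizes-sound (λ a → forSizes (p a)) t sa) sb

forSizes³-sound : ∀ (p : ℕ → ℕ → ℕ → Bool) → T (forSizes λ a → forSizes λ b → forSizes λ c → p a b c) →
  ∀ {a b c} → Size a → Size b → Size c → T (p a b c)
forSizes³-sound p t sa sb sc = forSizes-sound (p _ _) (forSizes²-sound (λ a b → forSizes (p a b)) t sa sb) sc

forSizes⁴-sound : ∀ (p : ℕ → ℕ → ℕ → ℕ → Bool) →
  T (forSizes λ a → forSizes λ b → forSizes λ c → forSizes λ e → p a b c e) →
  ∀ {a b c e} → Size a → Size b → Size c → Size e → T (p a b c e)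
forSizes⁴-sound p t sa sb sc se =
  forSizes-sound (p _ _ _) (forSizes³-sound (λ a b c → forSizes (p a b c)) t sa sb sc) se

-- The next four bounds are checked by evaluating them on all sizes 1, …, 4.
potential-start : ∀ {a b c} → Size a → Size b → Size c →
  Admissible₃ a b c → 10 + potential a b c ≤ 2 * (a + b + c)
potential-start sa sb sc = toWitness (forSizes³-sound
  (λ a b c → ⌊ admissible₃? a b c →-dec 10 + potential a b c ≤? 2 * (a + b + c) ⌋) tt sa sb sc)

potential-step : ∀ {a b c e} → Size a → Size b → Size c → Size e →
  Admissible₃ a b c → ¬ Forbidden₂ c e → ¬ Forbidden₃ b c e → ¬ Forbidden₄ a b c e →
  potential b c e + 5 ≤ potential a b c + 2 * e
potential-step sa sb sc se = toWitness (forSizes⁴-sound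
  (λ a b c e → ⌊ admissible₃? a b c →-dec ¬? (forbidden₂? c e) →-dec ¬? (forbidden₃? b c e) →-dec
                 ¬? (forbidden₄? a b c e) →-dec potential b c e + 5 ≤? potential a b c + 2 * e ⌋) tt sa sb sc se)

potential-end : ∀ {a b c} → Size a → Size b → Size c →
  Admissible₃ a b c → ¬ ForbiddenEnd b c → 3 ≤ potential a b c
potential-end sa sb sc = toWitness (forSizes³-sound
  (λ a b c → ⌊ admissible₃? a b c →-dec ¬? (forbiddenEnd? b c) →-dec 3 ≤? potential a b c ⌋) tt sa sb sc)

pair-bound : ∀ {a b} → Size a → Size b → ¬ Forbidden₂ a b → 8 ≤ 2 * (a + b)
pair-bound sa sb = toWitness (forSizes²-sound (λ a b → ⌊ ¬? (forbidden₂? a b) →-dec 8 ≤? 2 * (a + b) ⌋) tt sa sb)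

step-arithmetic : ∀ k σ e {p p′} → 5 * (2 + k) + p ≤ 2 * σ → p′ + 5 ≤ p + 2 * e →
                  5 * (3 + k) + p′ ≤ 2 * (σ + e)
step-arithmetic k σ e {p} {p′} inv decrease = begin
  5 * (3 + k) + p′          ≡⟨ regroup k p′ ⟩
  5 * (2 + k) + (p′ + 5)    ≤⟨ +-monoʳ-≤ (5 * (2 + k)) decrease ⟩
  5 * (2 + k) + (p + 2 * e) ≡⟨ +-assoc (5 * (2 + k)) p (2 * e) ⟨
  5 * (2 + k) + p + 2 * e   ≤⟨ +-monoˡ-≤ (2 * e) inv ⟩
  2 * σ + 2 * e             ≡⟨ *-distribˡ-+ 2 σ e ⟨
  2 * (σ + e)               ∎
  where
  open ≤-Reasoning
  regroup : ∀ k p′ → 5 * (3 + k) + p′ ≡ 5 * (2 + k) + (p′ + 5)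
  regroup = solve-∀

module _ {d : ℕ} {s : ℕ → ℕ} (adm : Admissible d s) where
  open Admissible adm

  private
    earlier : ∀ {i} → suc i ≤ d → i ≤ d
    earlier {i} = ≤-trans (n≤1+n i)

    admissible₃ : ∀ k → 2 + k ≤ d → Admissible₃ (s k) (s (1 + k)) (s (2 + k))
    admissible₃ k h = no-window₂ k (earlier h) , no-window₂ (1 + k) h , no-window₃ k h

  potential-invariant : ∀ k → 2 + k ≤ d →
    5 * (2 + k) + potential (s k) (s (1 + k)) (s (2 + k)) ≤ 2 * partialSum s (2 + k)
  potential-invariant zero h =
    potential-start (sizes 0 (earlier (earlier h))) (sizes 1 (earlier h)) (sizes 2 h) (admissible₃ 0 h)
  potential-invariant (suc k) h =
    step-arithmetic k (partialSum s (2 + k)) (s (3 + k)) (potential-invariant k (earlier h))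
      (potential-step (sizes k (earlier (earlier (earlier h)))) (sizes (1 + k) (earlier (earlier h)))
                      (sizes (2 + k) (earlier h)) (sizes (3 + k) h)
                      (admissible₃ k (earlier h)) (no-window₂ (2 + k) h) (no-window₃ (1 + k) h) (no-window₄ k h))

  admissible-sum : 1 ≤ d → 5 * d + 3 ≤ 2 * partialSum s d
  admissible-sum 1≤d = bound-at d refl 1≤d
    where
    bound-at : ∀ e → e ≡ d → 1 ≤ e → 5 * e + 3 ≤ 2 * partialSum s e
    bound-at 1 refl _ = pair-bound (sizes 0 z≤n) (sizes 1 ≤-refl) (no-window₂ 0 ≤-refl)
    bound-at (suc (suc k)) refl _ = ≤-trans (+-monoʳ-≤ (5 * (2 + k)) end) (potential-invariant k ≤-refl)
      where
      end : 3 ≤ potential (s k) (s (1 + k)) (s (2 + k))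
      end = potential-end (sizes k (earlier (earlier ≤-refl))) (sizes (1 + k) (earlier ≤-refl)) (sizes (2 + k) ≤-refl)
                          (admissible₃ k ≤-refl) (no-end (1 + k) refl)

∨-true : ∀ {x y : Bool} → x ∨ y ≡ true → x ≡ true ⊎ y ≡ true
∨-true {true}  _ = inj₁ refl
∨-true {false} e = inj₂ e

∨-false : ∀ {x y : Bool} → x ∨ y ≡ false → x ≡ false × y ≡ false
∨-false {false} e = refl , e

∨-introˡ : ∀ {x : Bool} {y} → x ≡ true → x ∨ y ≡ true
∨-introˡ refl = refl

∨-false-intro : ∀ {x y : Bool} → x ≡ false → y ≡ false → x ∨ y ≡ false
∨-false-intro refl refl = refl

∨-introʳ : ∀ (x : Bool) {y} → y ≡ true → x ∨ y ≡ true
∨-introʳ x refl = ∨-zeroʳ x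

∧-true : ∀ {x y : Bool} → x ∧ y ≡ true → x ≡ true × y ≡ true
∧-true {true} e = refl , e

∧-intro : ∀ {x y : Bool} → x ≡ true → y ≡ true → x ∧ y ≡ true
∧-intro refl refl = refl

not-true : ∀ {x : Bool} → not x ≡ true → x ≡ false
not-true {false} _ = refl

true≢false : ∀ {x : Bool} → x ≡ true → x ≡ false → ⊥
true≢false refl ()

private variable
  A B : Set

In₂ : A → A → A → Set
In₂ x a b = x ≡ a ⊎ x ≡ b

In₃ : A → A → A → A → Set
In₃ x a b c = x ≡ a ⊎ x ≡ b ⊎ x ≡ c

record Three (P : A → Set) : Set where
  constructor three
  field
    {x₁ x₂ x₃} : A
    px₁ : P x₁
    px₂ : P x₂
    px₃ : P x₃
    x₁≢x₂ : x₁ ≢ x₂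
    x₁≢x₃ : x₁ ≢ x₃
    x₂≢x₃ : x₂ ≢ x₃

record Two (P : A → Set) : Set where
  constructor two
  field
    {y₁ y₂} : A
    py₁ : P y₁
    py₂ : P y₂
    y₁≢y₂ : y₁ ≢ y₂

≢-sym : ∀ {x y : A} → x ≢ y → y ≢ x
≢-sym x≢y y≡x = x≢y (sym y≡x)

pigeonhole₂ : ∀ {a b x y z : A} → In₂ x a b → In₂ y a b → In₂ z a b → x ≡ y ⊎ x ≡ z ⊎ y ≡ z
pigeonhole₂ (inj₁ refl) (inj₁ refl) _           = inj₁ refl
pigeonhole₂ (inj₂ refl) (inj₂ refl) _           = inj₁ refl
pigeonhole₂ (inj₁ refl) (inj₂ refl) (inj₁ refl) = inj₂ (inj₁ refl)
pigeonhole₂ (inj₁ refl) (inj₂ refl) (inj₂ refl) = inj₂ (inj₂ refl)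
pigeonhole₂ (inj₂ refl) (inj₁ refl) (inj₁ refl) = inj₂ (inj₂ refl)
pigeonhole₂ (inj₂ refl) (inj₁ refl) (inj₂ refl) = inj₂ (inj₁ refl)

In₂-other : ∀ {a b x y z : A} → x ≢ y → In₂ x a b → In₂ y a b → In₂ z a b → In₂ z x y
In₂-other x≢y x∈ y∈ z∈ with pigeonhole₂ x∈ y∈ z∈
... | inj₁ x≡y        = ⊥-elim (x≢y x≡y)
... | inj₂ (inj₁ x≡z) = inj₁ (sym x≡z)
... | inj₂ (inj₂ y≡z) = inj₂ (sym y≡z)

three-not-in-two : ∀ {P : A → Set} {a b} → Three P → (∀ {x} → P x → In₂ x a b) → ⊥
three-not-in-two (three p₁ p₂ p₃ ≢₁₂ ≢₁₃ ≢₂₃) ⊆ab with pigeonhole₂ (⊆ab p₁) (⊆ab p₂) (⊆ab p₃)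
... | inj₁ e        = ≢₁₂ e
... | inj₂ (inj₁ e) = ≢₁₃ e
... | inj₂ (inj₂ e) = ≢₂₃ e

four-not-in-three : ∀ {a b c x y z w : A} → In₃ x a b c → In₃ y a b c → In₃ z a b c → In₃ w a b c →
  x ≢ y → x ≢ z → x ≢ w → y ≢ z → y ≢ w → z ≢ w → ⊥
four-not-in-three {a = a} {b = b} {c = c} {x = x} {y = y} {z = z} {w = w}
                  x∈ y∈ z∈ w∈ x≢y x≢z x≢w y≢z y≢w z≢w = case x∈
  where
  rest : ∀ {a′ b′ c′} → In₃ y a′ b′ c′ → In₃ z a′ b′ c′ → In₃ w a′ b′ c′ → x ≡ a′ → ⊥
  rest y∈′ z∈′ w∈′ refl =
    three-not-in-two (three (drop y∈′ x≢y) (drop z∈′ x≢z) (drop w∈′ x≢w) y≢z y≢w z≢w) (λ t∈ → t∈)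
    where
    drop : ∀ {t b′ c′} → In₃ t x b′ c′ → x ≢ t → In₂ t b′ c′
    drop (inj₁ t≡x) x≢t = ⊥-elim (x≢t (sym t≡x))
    drop (inj₂ t∈)  _   = t∈
  case : In₃ x a b c → ⊥
  case (inj₁ x≡a)        = rest y∈ z∈ w∈ x≡a
  case (inj₂ (inj₁ x≡b)) = rest (rotate y∈) (rotate z∈) (rotate w∈) x≡b
    where
    rotate : ∀ {t} → In₃ t a b c → In₃ t b a c
    rotate (inj₁ e)        = inj₂ (inj₁ e)
    rotate (inj₂ (inj₁ e)) = inj₁ e
    rotate (inj₂ (inj₂ e)) = inj₂ (inj₂ e)
  case (inj₂ (inj₂ x≡c)) = rest (rotate y∈) (rotate z∈) (rotate w∈) x≡c
    where
    rotate : ∀ {t} → In₃ t a b c → In₃ t c a b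
    rotate (inj₁ e)        = inj₂ (inj₁ e)
    rotate (inj₂ (inj₁ e)) = inj₂ (inj₂ e)
    rotate (inj₂ (inj₂ e)) = inj₁ e

In₃-other : DecidableEquality A → ∀ {a b c x y z t : A} →
  In₃ x a b c → In₃ y a b c → In₃ z a b c → In₃ t a b c → x ≢ y → x ≢ z → y ≢ z → In₃ t x y z
In₃-other _≟_ {x = x} {y = y} {z = z} {t = t} x∈ y∈ z∈ t∈ x≢y x≢z y≢z with t ≟ x | t ≟ y | t ≟ z
... | yes t≡x | _       | _       = inj₁ t≡x
... | no _    | yes t≡y | _       = inj₂ (inj₁ t≡y)
... | no _    | no _    | yes t≡z = inj₂ (inj₂ t≡z)
... | no t≢x  | no t≢y  | no t≢z  = ⊥-elim (four-not-in-three t∈ x∈ y∈ z∈ t≢x t≢y t≢z x≢y x≢z y≢z)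

module _ {P : A → Set} where

  two-others : ∀ {Q : A → Set} (o : A) → (∀ {x} → P x → x ≡ o ⊎ Q x) → Three P → Two Q
  two-others o classify (three p₁ p₂ p₃ ≢₁₂ ≢₁₃ ≢₂₃) with classify p₁ | classify p₂ | classify p₃
  ... | inj₂ q₁ | inj₂ q₂ | _       = two q₁ q₂ ≢₁₂
  ... | inj₂ q₁ | inj₁ _  | inj₂ q₃ = two q₁ q₃ ≢₁₃
  ... | inj₁ _  | inj₂ q₂ | inj₂ q₃ = two q₂ q₃ ≢₂₃
  ... | inj₁ e₁ | inj₁ e₂ | _       = ⊥-elim (≢₁₂ (trans e₁ (sym e₂)))
  ... | inj₁ e₁ | inj₂ _  | inj₁ e₃ = ⊥-elim (≢₁₃ (trans e₁ (sym e₃)))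
  ... | inj₂ _  | inj₁ e₂ | inj₁ e₃ = ⊥-elim (≢₂₃ (trans e₂ (sym e₃)))

  one-other : ∀ {Q : A → Set} (a b : A) → (∀ {x} → P x → In₂ x a b ⊎ Q x) → Three P → Σ A Q
  one-other a b classify (three p₁ p₂ p₃ ≢₁₂ ≢₁₃ ≢₂₃) with classify p₁ | classify p₂ | classify p₃
  ... | inj₂ q₁ | _       | _       = _ , q₁
  ... | inj₁ _  | inj₂ q₂ | _       = _ , q₂
  ... | inj₁ _  | inj₁ _  | inj₂ q₃ = _ , q₃
  ... | inj₁ i₁ | inj₁ i₂ | inj₁ i₃ =
    ⊥-elim (three-not-in-two (three i₁ i₂ i₃ ≢₁₂ ≢₁₃ ≢₂₃) (λ i → i))

  Three-map : ∀ {Q : B → Set} (f : A → B) → (∀ {x} → P x → Q (f x)) →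
              (∀ {x y} → P x → P y → f x ≡ f y → x ≡ y) → Three P → Three Q
  Three-map f pq inj (three p₁ p₂ p₃ ≢₁₂ ≢₁₃ ≢₂₃) =
    three (pq p₁) (pq p₂) (pq p₃)
      (λ e → ≢₁₂ (inj p₁ p₂ e)) (λ e → ≢₁₃ (inj p₁ p₃ e)) (λ e → ≢₂₃ (inj p₂ p₃ e))

  Three-extend : ∀ {R : A → B → Set} → (∀ {x} → P x → Σ B (R x)) →
                 Three P → Three {A = A × B} (λ (x , y) → P x × R x y)
  Three-extend witness (three p₁ p₂ p₃ ≢₁₂ ≢₁₃ ≢₂₃) =
    three (p₁ , proj₂ (witness p₁)) (p₂ , proj₂ (witness p₂)) (p₃ , proj₂ (witness p₃))
      (≢₁₂ ∘ proj₁ ∘ ,-injective) (≢₁₃ ∘ proj₁ ∘ ,-injective) (≢₂₃ ∘ proj₁ ∘ ,-injective)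

  collide : ∀ (f : A → B) {b b′} → (∀ {x} → P x → In₂ (f x) b b′) →
            Three P → Σ (Three P) λ t → f (Three.x₁ t) ≡ f (Three.x₂ t)
  collide f f∈ t@(three p₁ p₂ p₃ ≢₁₂ ≢₁₃ ≢₂₃) with pigeonhole₂ (f∈ p₁) (f∈ p₂) (f∈ p₃)
  ... | inj₁ e        = t , e
  ... | inj₂ (inj₁ e) = three p₁ p₃ p₂ ≢₁₃ ≢₁₂ (≢-sym ≢₂₃) , e
  ... | inj₂ (inj₂ e) = three p₂ p₃ p₁ ≢₂₃ (≢-sym ≢₁₂) (≢-sym ≢₁₃) , e

-- Balls, cuts and distance layers

exists : ∀ {m} → (Fin m → Bool) → Bool
exists {zero}  f = false
exists {suc m} f = f fzero ∨ exists (λ x → f (fsuc x))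

exists-elim : ∀ {m} (f : Fin m → Bool) → exists f ≡ true → Σ (Fin m) λ x → f x ≡ true
exists-elim {suc m} f e with ∨-true {f fzero} e
... | inj₁ p = fzero , p
... | inj₂ p = let x , q = exists-elim (λ x → f (fsuc x)) p in fsuc x , q

exists-intro : ∀ {m} (f : Fin m → Bool) x → f x ≡ true → exists f ≡ true
exists-intro f fzero    p rewrite p = refl
exists-intro f (fsuc x) p = ∨-introʳ (f fzero) (exists-intro (λ y → f (fsuc y)) x p)

module Ball {n : ℕ} (R : Fin n → Fin n → Bool) where

  ball : Fin n → ℕ → Fin n → Bool
  ball v zero    x = ⌊ x ≟ v ⌋
  ball v (suc k) x = ball v k x ∨ exists (λ y → ball v k y ∧ R y x)

  ball-suc : ∀ v k {x} → ball v k x ≡ true → ball v (suc k) x ≡ true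
  ball-suc v k p rewrite p = refl

  ball-mono : ∀ v x {k l} → k ≤ l → ball v k x ≡ true → ball v l x ≡ true
  ball-mono v x {l = zero}  z≤n     p = p
  ball-mono v x {l = suc l} k≤1+l p with m≤n⇒m<n∨m≡n k≤1+l
  ... | inj₁ (s≤s k≤l) = ball-suc v l (ball-mono v x k≤l p)
  ... | inj₂ refl      = p

  centre∈ball : ∀ v k → ball v k v ≡ true
  centre∈ball v zero    with v ≟ v
  ... | yes _   = refl
  ... | no v≢v = ⊥-elim (v≢v refl)
  centre∈ball v (suc k) = ball-suc v k (centre∈ball v k)

  ball-zero : ∀ v x → ball v zero x ≡ true → x ≡ v
  ball-zero v x p with x ≟ v
  ... | yes x≡v = x≡v
  ... | no  _   = ⊥-elim (true≢false p refl)

  ball-zero-outside : ∀ v x → x ≢ v → ball v zero x ≡ false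
  ball-zero-outside v x x≢v with x ≟ v
  ... | yes x≡v = ⊥-elim (x≢v x≡v)
  ... | no  _   = refl

  ball-zero-false : ∀ v x → ball v zero x ≡ false → x ≢ v
  ball-zero-false v x x∉ refl = true≢false (centre∈ball v zero) x∉

  ball-step : ∀ v k {x y} → ball v k x ≡ true → R x y ≡ true → ball v (suc k) y ≡ true
  ball-step v k {x} {y} x∈ a = ∨-introʳ (ball v k y) (exists-intro _ x (∧-intro x∈ a))

  ball-suc-inv : ∀ v k y → ball v (suc k) y ≡ true →
                 ball v k y ≡ true ⊎ Σ (Fin n) λ x → ball v k x ≡ true × R x y ≡ true
  ball-suc-inv v k y p with ∨-true {ball v k y} p
  ... | inj₁ q = inj₁ q
  ... | inj₂ q = let x , r = exists-elim _ q in inj₂ (x , ∧-true r)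

  ball-cons : ∀ v k {w x} → R v w ≡ true → ball w k x ≡ true → ball v (suc k) x ≡ true
  ball-cons v zero    a p rewrite ball-zero _ _ p = ball-step v zero (centre∈ball v zero) a
  ball-cons v (suc k) {w} {x} a p with ball-suc-inv w k x p
  ... | inj₁ q           = ball-suc v (suc k) (ball-cons v k a q)
  ... | inj₂ (y , q , b) = ball-step v (suc k) (ball-cons v k a q) b

  walk→ball : ∀ {v x m} → Walk R v x m → ball v m x ≡ true
  walk→ball {v} []                 = centre∈ball v zero
  walk→ball {v} (step {k = k} a w) = ball-cons v k a (walk→ball w)

  snoc : ∀ {v y x m} → Walk R v y m → R y x ≡ true → Walk R v x (suc m)
  snoc []         a = step a []
  snoc (step b w) a = step b (snoc w a)

  ball→walk : ∀ v k x → ball v k x ≡ true → Σ ℕ λ m → m ≤ k × Walk R v x m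
  ball→walk v zero x p rewrite ball-zero v x p = zero , z≤n , []
  ball→walk v (suc k) x p with ball-suc-inv v k x p
  ... | inj₁ q = let m , m≤k , w = ball→walk v k x q in m , ≤-trans m≤k (n≤1+n k) , w
  ... | inj₂ (y , q , a) = let m , m≤k , w = ball→walk v k y q in suc m , s≤s m≤k , snoc w a

another-vertex : ∀ {m} → 2 ≤ m → (x : Fin m) → Σ (Fin m) λ y → y ≢ x
another-vertex {suc (suc _)} _ fzero    = fsuc fzero , λ ()
another-vertex {suc (suc _)} _ (fsuc _) = fzero , λ ()
another-vertex {suc zero} (s≤s ()) _

leaving-edge : ∀ {n} {B : Fin n → Fin n → Bool} (S : Fin n → Bool) {s t m} →
  S s ≡ true → S t ≡ false → Walk B s t m →
  Σ (Fin n × Fin n) λ (p , q) → S p ≡ true × S q ≡ false × B p q ≡ true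
leaving-edge S s∈ t∉ []                         = ⊥-elim (true≢false s∈ t∉)
leaving-edge S s∈ t∉ (step {w = w} a rest) with S w in w∈
... | true  = leaving-edge S w∈ t∉ rest
... | false = (_ , w) , s∈ , w∈ , a

samePair-false : ∀ {n} {p q x y : Fin n} → samePair p q x y ≡ false → (p , q) ≢ (x , y)
samePair-false {p = p} {q} e refl with p ≟ p | q ≟ q
... | yes _ | yes _ = true≢false refl e
... | no p≢p | _    = p≢p refl
... | yes _ | no q≢q = q≢q refl

Crossing : ∀ {n} → Graph n → (Fin n → Bool) → Fin n × Fin n → Set
Crossing G S (p , q) = S p ≡ true × S q ≡ false × Adj G p q

module EdgeConnectivity3 {n : ℕ} (G : Graph n)
  (ec : ∀ (x₁ y₁ x₂ y₂ : Fin n) → ConnectedRel (delete2 G x₁ y₁ x₂ y₂)) where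

  crossing-edge-avoiding : ∀ S {s t} → S s ≡ true → S t ≡ false →
    ∀ e₁ e₂ → Σ (Fin n × Fin n) λ e → Crossing G S e × e ≢ e₁ × e ≢ e₂
  crossing-edge-avoiding S {s} {t} s∈ t∉ (x₁ , y₁) (x₂ , y₂) with ec x₁ y₁ x₂ y₂ s t
  ... | _ , walk with leaving-edge S s∈ t∉ walk
  ...   | e , p∈ , q∉ , kept with ∧-true kept
  ...     | a , rest with ∧-true rest
  ...       | ≢e₁ , ≢e₂ = e , (p∈ , q∉ , a) , samePair-false (not-true ≢e₁) , samePair-false (not-true ≢e₂)

  -- Opaque (as is layer-edges below) so that case splits on the edges do not unfold their construction.
  opaque
    three-crossing-edges : ∀ S {s t} → S s ≡ true → S t ≡ false → Three (Crossing G S)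
    three-crossing-edges S {s} s∈ t∉ =
      let e₁ , c₁ , _ , _       = crossing-edge-avoiding S s∈ t∉ (s , s) (s , s)
          e₂ , c₂ , e₂≢e₁ , _    = crossing-edge-avoiding S s∈ t∉ e₁ e₁
          e₃ , c₃ , e₃≢e₁ , e₃≢e₂ = crossing-edge-avoiding S s∈ t∉ e₁ e₂
      in three c₁ c₂ c₃ (≢-sym e₂≢e₁) (≢-sym e₃≢e₁) (≢-sym e₃≢e₂)

  three-neighbours : 2 ≤ n → ∀ p → Three (Adj G p)
  three-neighbours 2≤n p = Three-map proj₂ adjacent second-injective edges
    where
    open Ball (adj G) using (ball; centre∈ball; ball-zero; ball-zero-outside)
    edges : Three (Crossing G (ball p zero))
    edges = let t , t≢p = another-vertex 2≤n p in
      three-crossing-edges (ball p zero) (centre∈ball p zero) (ball-zero-outside p t t≢p)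
    from-p : ∀ {e} → Crossing G (ball p zero) e → proj₁ e ≡ p
    from-p (x∈ , _) = ball-zero p _ x∈
    adjacent : ∀ {e} → Crossing G (ball p zero) e → Adj G p (proj₂ e)
    adjacent c@(_ , _ , a) = subst (λ x → Adj G x _) (from-p c) a
    second-injective : ∀ {e e′} → Crossing G (ball p zero) e → Crossing G (ball p zero) e′ →
                       proj₂ e ≡ proj₂ e′ → e ≡ e′
    second-injective c c′ q≡q′ = ×-≡,≡→≡ (trans (from-p c) (sym (from-p c′)) , q≡q′)

module Adjacency {n : ℕ} (G : Graph n) where

  adj-flip : ∀ {x y} → Adj G x y → Adj G y x
  adj-flip {x} {y} a = trans (adj-sym G y x) a

  adj-≢ : ∀ {x y} → Adj G x y → x ≢ y
  adj-≢ {x} a refl = true≢false a (adj-irrefl G x)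

  no-two-common-neighbours : C4Free G → ∀ {x y z z′} → x ≢ y → z ≢ z′ →
    Adj G x z → Adj G x z′ → Adj G y z → Adj G y z′ → ⊥
  no-two-common-neighbours c4 {x} {y} {z} {z′} x≢y z≢z′ xz xz′ yz yz′ =
    c4 x z y z′ (adj-≢ xz) x≢y (adj-≢ xz′) (adj-≢ (adj-flip yz)) z≢z′ (adj-≢ yz′)
       (xz , adj-flip yz , yz′ , adj-flip xz′)

length-filterᵇ-split : ∀ (p q : A → Bool) → (∀ x → p x ≡ true → q x ≡ true) → ∀ xs →
  length (filterᵇ q xs) ≡ length (filterᵇ p xs) + length (filterᵇ (λ x → q x ∧ not (p x)) xs)
length-filterᵇ-split p q p⇒q []       = refl
length-filterᵇ-split p q p⇒q (x ∷ xs) with p x in px | q x in qx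
... | true  | true  = cong suc (length-filterᵇ-split p q p⇒q xs)
... | true  | false = ⊥-elim (true≢false (p⇒q x px) qx)
... | false | true  = trans (cong suc (length-filterᵇ-split p q p⇒q xs)) (sym (+-suc _ _))
... | false | false = length-filterᵇ-split p q p⇒q xs

short-list₁ : (xs : List A) → length xs ≤ 1 → A → Σ A λ a → ∀ {x} → x ∈ xs → x ≡ a
short-list₁ []      _ a = a , λ ()
short-list₁ (a ∷ []) _ _ = a , λ { (here x≡a) → x≡a }
short-list₁ (_ ∷ _ ∷ _) (s≤s ()) _

short-list₂ : (xs : List A) → length xs ≤ 2 → A → Σ A λ a → Σ A λ b → ∀ {x} → x ∈ xs → In₂ x a b
short-list₂ []            _ a = a , a , λ ()
short-list₂ (a ∷ [])      _ _ = a , a , λ { (here x≡a) → inj₁ x≡a }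
short-list₂ (a ∷ b ∷ [])  _ _ = a , b , λ { (here x≡a) → inj₁ x≡a ; (there (here x≡b)) → inj₂ x≡b }
short-list₂ (_ ∷ _ ∷ _ ∷ _) (s≤s (s≤s ())) _

short-list₃ : (xs : List A) → length xs ≤ 3 → A → Σ A λ a → Σ A λ b → Σ A λ c → ∀ {x} → x ∈ xs → In₃ x a b c
short-list₃ []                _ a = a , a , a , λ ()
short-list₃ (a ∷ [])          _ _ = a , a , a , λ { (here x≡a) → inj₁ x≡a }
short-list₃ (a ∷ b ∷ [])      _ _ = a , b , b , λ { (here x≡a) → inj₁ x≡a ; (there (here x≡b)) → inj₂ (inj₁ x≡b) }
short-list₃ (a ∷ b ∷ c ∷ [])  _ _ =
  a , b , c , λ { (here x≡a) → inj₁ x≡a ; (there (here x≡b)) → inj₂ (inj₁ x≡b)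
                ; (there (there (here x≡c))) → inj₂ (inj₂ x≡c) }
short-list₃ (_ ∷ _ ∷ _ ∷ _ ∷ _) (s≤s (s≤s (s≤s ()))) _

m⊓4≤k⇒m≤k : ∀ m {k} → m ⊓ 4 ≤ k → k < 4 → m ≤ k
m⊓4≤k⇒m≤k m m⊓4≤k k<4 with ⊓-sel m 4
... | inj₁ m⊓4≡m = subst (_≤ _) m⊓4≡m m⊓4≤k
... | inj₂ m⊓4≡4 = ⊥-elim (1+n≰n (≤-<-trans (subst (_≤ _) m⊓4≡4 m⊓4≤k) k<4))

module Layers {n : ℕ} (G : Graph n) (u : Fin n) (d : ℕ)
  (ecc : ∀ x → Ball.ball (adj G) u d x ≡ true) where
  open Ball (adj G)
  open Adjacency G

  layer : ℕ → Fin n → Bool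
  layer zero    x = ball u zero x
  layer (suc i) x = ball u (suc i) x ∧ not (ball u i x)

  record Layer (i : ℕ) (x : Fin n) : Set where
    constructor in-layer
    field layer≡true : layer i x ≡ true

  layer⇒ball : ∀ {i x} → Layer i x → ball u i x ≡ true
  layer⇒ball {zero}  (in-layer p) = p
  layer⇒ball {suc i} (in-layer p) = proj₁ (∧-true p)

  layer⇒∉ball : ∀ {i x k} → Layer i x → k < i → ball u k x ≡ false
  layer⇒∉ball {suc i} {x} {k} (in-layer p) (s≤s k≤i) with ball u k x in k∈
  ... | false = refl
  ... | true  = ⊥-elim (true≢false (ball-mono u x k≤i k∈) (not-true (proj₂ (∧-true p))))

  layer-unique : ∀ {i j x} → Layer i x → Layer j x → i ≡ j
  layer-unique {i} {j} x∈i x∈j with <-cmp i j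
  ... | tri< i<j _ _ = ⊥-elim (true≢false (layer⇒ball x∈i) (layer⇒∉ball x∈j i<j))
  ... | tri≈ _ i≡j _ = i≡j
  ... | tri> _ _ j<i = ⊥-elim (true≢false (layer⇒ball x∈j) (layer⇒∉ball x∈i j<i))

  layers-disjoint : ∀ {i j x y} → Layer i x → Layer j y → i ≢ j → x ≢ y
  layers-disjoint x∈i y∈j i≢j refl = i≢j (layer-unique x∈i y∈j)

  ball⇒layer : ∀ k x → ball u k x ≡ true → Σ ℕ λ i → i ≤ k × Layer i x
  ball⇒layer zero    x p = zero , z≤n , in-layer p
  ball⇒layer (suc k) x p = by-cases (ball u k x) refl
    where
    by-cases : ∀ b → ball u k x ≡ b → Σ ℕ λ i → i ≤ suc k × Layer i x
    by-cases true  k∈ = let i , i≤k , x∈i = ball⇒layer k x k∈ in i , ≤-trans i≤k (n≤1+n k) , x∈i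
    by-cases false k∉ = suc k , ≤-refl , in-layer (∧-intro p (cong not k∉))

  layer-of : ∀ x → Σ ℕ λ i → i ≤ d × Layer i x
  layer-of x = ball⇒layer d x (ecc x)

  no-layer-beyond : ∀ {x} → ¬ Layer (suc d) x
  no-layer-beyond x∈ = let i , i≤d , x∈i = layer-of _ in 1+n≰n (subst (_≤ d) (layer-unique x∈i x∈) i≤d)

  eccentricity-positive : 2 ≤ n → 1 ≤ d
  eccentricity-positive 2≤n with another-vertex 2≤n u
  ... | x , x≢u with layer-of x
  ...   | zero  , _   , in-layer x∈ = ⊥-elim (x≢u (ball-zero u x x∈))
  ...   | suc _ , i≤d , _           = ≤-trans (s≤s z≤n) i≤d

  edge-climbs-one : ∀ {i j x y} → Adj G x y → Layer i x → Layer j y → j ≤ suc i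
  edge-climbs-one {i} {j} a x∈i y∈j with j ≤? suc i
  ... | yes j≤1+i = j≤1+i
  ... | no  j≰1+i = ⊥-elim (true≢false (ball-step u i (layer⇒ball x∈i) a) (layer⇒∉ball y∈j (≰⇒> j≰1+i)))

  neighbour-layer : ∀ {i x t} → Adj G x t → Layer (suc i) x →
    Layer i t ⊎ Layer (suc i) t ⊎ Layer (suc (suc i)) t
  neighbour-layer {i} {x} {t} a x∈ with layer-of t
  ... | j , _ , t∈j = place j t∈j (≤-pred (edge-climbs-one (adj-flip a) t∈j x∈)) (edge-climbs-one a x∈ t∈j)
    where
    place : ∀ j → Layer j t → i ≤ j → j ≤ suc (suc i) → Layer i t ⊎ Layer (suc i) t ⊎ Layer (suc (suc i)) t
    place j t∈j i≤j j≤2+i with m≤n⇒m<n∨m≡n i≤j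
    ... | inj₂ refl = inj₁ t∈j
    ... | inj₁ i<j with m≤n⇒m<n∨m≡n i<j
    ...   | inj₂ refl = inj₂ (inj₁ t∈j)
    ...   | inj₁ 1+i<j rewrite ≤-antisym j≤2+i 1+i<j = inj₂ (inj₂ t∈j)

  parent : ∀ {i y} → Layer (suc i) y → Σ (Fin n) λ x → Layer i x × Adj G x y
  parent {i} {y} y∈ with ball-suc-inv u i y (layer⇒ball y∈)
  ... | inj₁ y∈ball = ⊥-elim (true≢false y∈ball (layer⇒∉ball y∈ ≤-refl))
  ... | inj₂ (x , x∈ball , a) with ball⇒layer i x x∈ball
  ...   | j , j≤i , x∈j with m≤n⇒m<n∨m≡n j≤i
  ...     | inj₂ refl = x , x∈j , a
  ...     | inj₁ j<i  = ⊥-elim (true≢false (ball-step u j (layer⇒ball x∈j) a) (layer⇒∉ball y∈ (s≤s j<i)))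

  crossing-ball : ∀ {i p q} → Crossing G (ball u i) (p , q) → Layer i p × Layer (suc i) q
  crossing-ball {i} {p} {q} (p∈ , q∉ , a) with ball⇒layer i p p∈ | layer-of q
  ... | j , j≤i , p∈j | k , _ , q∈k with k ≤? i
  ... | yes k≤i = ⊥-elim (true≢false (ball-mono u q k≤i (layer⇒ball q∈k)) q∉)
  ... | no  k≰i = subst (λ z → Layer z p) j≡i p∈j , subst (λ z → Layer z q) k≡1+i q∈k
    where
    k≤1+j : k ≤ suc j
    k≤1+j = edge-climbs-one a p∈j q∈k
    j≡i : j ≡ i
    j≡i = ≤-antisym j≤i (≤-pred (≤-trans (≰⇒> k≰i) k≤1+j))
    k≡1+i : k ≡ suc i
    k≡1+i = ≤-antisym (≤-trans k≤1+j (s≤s j≤i)) (≰⇒> k≰i)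

  far⇒layer : ∀ {w} → (∀ m → m < d → ¬ Walk (adj G) u w m) → Layer d w
  far⇒layer {w} far with layer-of w
  ... | i , i≤d , w∈i with m≤n⇒m<n∨m≡n i≤d
  ...   | inj₂ refl = w∈i
  ...   | inj₁ i<d  =
    let m , m≤i , walk = ball→walk u i w (layer⇒ball w∈i) in ⊥-elim (far m (≤-<-trans m≤i i<d) walk)

  layer-inhabited : ∀ {w} → Layer d w → ∀ i → i ≤ d → Σ (Fin n) (Layer i)
  layer-inhabited {w} w∈d i i≤d = descend (d ∸ i) i (m+[n∸m]≡n i≤d)
    where
    descend : ∀ k i → i + k ≡ d → Σ (Fin n) (Layer i)
    descend zero    i i+0≡d = w , subst (λ j → Layer j w) (trans (sym i+0≡d) (+-identityʳ i)) w∈d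
    descend (suc k) i i+1+k≡d =
      let y , y∈ = descend k (suc i) (trans (sym (+-suc i k)) i+1+k≡d)
          x , x∈ , _ = parent y∈
      in x , x∈

  members : ℕ → List (Fin n)
  members i = filterᵇ (layer i) (allFin n)

  ∈members : ∀ {i x} → Layer i x → x ∈ members i
  ∈members {i} (in-layer p) = ∈-filter⁺ (T? ∘ layer i) (∈-allFin _) (subst T (sym p) tt)

  ball-size : ∀ k xs → length (filterᵇ (ball u k) xs) ≡ partialSum (λ i → length (filterᵇ (layer i) xs)) k
  ball-size zero    xs = refl
  ball-size (suc k) xs =
    trans (length-filterᵇ-split (ball u k) (ball u (suc k)) (λ _ → ball-suc u k) xs)
          (cong (_+ length (filterᵇ (layer (suc k)) xs)) (ball-size k xs))

  layer-sizes-total : partialSum (λ i → length (members i)) d ≤ n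
  layer-sizes-total = begin
    partialSum (λ i → length (members i)) d ≡⟨ ball-size d (allFin n) ⟨
    length (filterᵇ (ball u d) (allFin n))  ≤⟨ length-filter (T? ∘ ball u d) (allFin n) ⟩
    length (allFin n)                       ≡⟨ length-tabulate id ⟩
    n                                       ∎
    where open ≤-Reasoning

  size : ℕ → ℕ
  size i = length (members i) ⊓ 4

  Layer⊆₁ : ℕ → Fin n → Set
  Layer⊆₁ i a = ∀ {x} → Layer i x → x ≡ a

  Layer⊆₂ : ℕ → Fin n → Fin n → Set
  Layer⊆₂ i a b = ∀ {x} → Layer i x → In₂ x a b

  Layer⊆₃ : ℕ → Fin n → Fin n → Fin n → Set
  Layer⊆₃ i a b c = ∀ {x} → Layer i x → In₃ x a b c

  size≤1 : ∀ {i} → size i ≤ 1 → Σ (Fin n) (Layer⊆₁ i)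
  size≤1 {i} s≤1 =
    let a , ⊆a = short-list₁ (members i) (m⊓4≤k⇒m≤k _ s≤1 (s≤s (s≤s z≤n))) u in a , ⊆a ∘ ∈members

  size≤2 : ∀ {i} → size i ≤ 2 → Σ (Fin n) λ a → Σ (Fin n) (Layer⊆₂ i a)
  size≤2 {i} s≤2 =
    let a , b , ⊆ab = short-list₂ (members i) (m⊓4≤k⇒m≤k _ s≤2 (s≤s (s≤s (s≤s z≤n)))) u in a , b , ⊆ab ∘ ∈members

  size≤3 : ∀ {i} → size i ≤ 3 → Σ (Fin n) λ a → Σ (Fin n) λ b → Σ (Fin n) (Layer⊆₃ i a b)
  size≤3 {i} s≤3 =
    let a , b , c , ⊆abc = short-list₃ (members i) (m⊓4≤k⇒m≤k _ s≤3 ≤-refl) u in a , b , c , ⊆abc ∘ ∈members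

  size≤length : ∀ i → size i ≤ length (members i)
  size≤length i = m⊓n≤m (length (members i)) 4

-- Small consecutive layers

module SmallLayers {n : ℕ} (G : Graph n) (c4 : C4Free G)
  (ec : ∀ (x₁ y₁ x₂ y₂ : Fin n) → ConnectedRel (delete2 G x₁ y₁ x₂ y₂))
  (2≤n : 2 ≤ n) (u : Fin n) (d : ℕ) (ecc : ∀ x → Ball.ball (adj G) u d x ≡ true)
  {w : Fin n} (w∈d : Layers.Layer G u d ecc d w) where
  open Ball (adj G)
  open Adjacency G
  open EdgeConnectivity3 G ec
  open Layers G u d ecc

  private
    _~_ : Fin n → Fin n → Set
    x ~ y = Adj G x y

    C4 : ∀ {x y z z′} → x ≢ y → z ≢ z′ → x ~ z → x ~ z′ → y ~ z → y ~ z′ → ⊥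
    C4 = no-two-common-neighbours c4

    i≢1+i : ∀ i → i ≢ suc i
    i≢1+i i ()

    i≢2+i : ∀ i → i ≢ suc (suc i)
    i≢2+i i ()

  LayerEdge : ℕ → Fin n × Fin n → Set
  LayerEdge i (p , q) = Layer i p × Layer (suc i) q × p ~ q

  opaque
    layer-edges : ∀ {i} → suc i ≤ d → Three (LayerEdge i)
    layer-edges {i} 1+i≤d =
      let t , t∈ = layer-inhabited w∈d (suc i) 1+i≤d in
      Three-map id (λ c → let p∈ , q∈ = crossing-ball c in p∈ , q∈ , proj₂ (proj₂ c)) (λ _ _ e → e)
        (three-crossing-edges (ball u i) (centre∈ball u i) (layer⇒∉ball t∈ ≤-refl))

  fan-up : ∀ {i b b′} → suc i ≤ d → Layer⊆₂ (suc i) b b′ →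
    Σ (Fin n) λ B → Layer (suc i) B × Two (λ q → Layer i q × q ~ B)
  fan-up h ⊆bb′ with collide proj₂ (λ (_ , q∈ , _) → ⊆bb′ q∈) (layer-edges h)
  ... | three (p₁∈ , q₁∈ , a₁) (p₂∈ , _ , a₂) _ e₁≢e₂ _ _ , refl =
    _ , q₁∈ , two (p₁∈ , a₁) (p₂∈ , a₂) (λ p₁≡p₂ → e₁≢e₂ (cong (_, _) p₁≡p₂))

  fan-down : ∀ {i a a′} → suc i ≤ d → Layer⊆₂ i a a′ →
    Σ (Fin n) λ P → Layer i P × Two (λ q → Layer (suc i) q × P ~ q)
  fan-down h ⊆aa′ with collide proj₁ (λ (p∈ , _) → ⊆aa′ p∈) (layer-edges h)
  ... | three (p₁∈ , q₁∈ , a₁) (_ , q₂∈ , a₂) _ e₁≢e₂ _ _ , refl =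
    _ , p₁∈ , two (q₁∈ , a₁) (q₂∈ , a₂) (λ q₁≡q₂ → e₁≢e₂ (cong (_ ,_) q₁≡q₂))

  ¬sizes-1-2 : ∀ {i a b b′} → suc i ≤ d → Layer⊆₁ i a → Layer⊆₂ (suc i) b b′ → ⊥
  ¬sizes-1-2 h ⊆a ⊆bb′ with fan-up h ⊆bb′
  ... | _ , _ , two (q∈ , _) (q′∈ , _) q≢q′ = q≢q′ (trans (⊆a q∈) (sym (⊆a q′∈)))

  ¬sizes-2-1 : ∀ {i a a′ b} → suc i ≤ d → Layer⊆₂ i a a′ → Layer⊆₁ (suc i) b → ⊥
  ¬sizes-2-1 h ⊆aa′ ⊆b with fan-down h ⊆aa′
  ... | _ , _ , two (q∈ , _) (q′∈ , _) q≢q′ = q≢q′ (trans (⊆b q∈) (sym (⊆b q′∈)))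

  ¬sizes-1-*-2 : ∀ {i x c c′} → suc (suc i) ≤ d → Layer⊆₁ i x → Layer⊆₂ (suc (suc i)) c c′ → ⊥
  ¬sizes-1-*-2 {i} {x} h ⊆x ⊆cc′ with fan-up h ⊆cc′
  ... | B , B∈ , two (q∈ , qB) (q′∈ , q′B) q≢q′ =
    C4 x≢B q≢q′ (from-x q∈) (from-x q′∈) (adj-flip qB) (adj-flip q′B)
    where
    from-x : ∀ {q} → Layer (suc i) q → x ~ q
    from-x q∈ = let r , r∈ , rq = parent q∈ in subst (_~ _) (⊆x r∈) rq
    x≢B : x ≢ B
    x≢B x≡B = let r , r∈ , _ = parent q∈ in layers-disjoint r∈ B∈ (i≢2+i i) (trans (⊆x r∈) x≡B)

  ⊆₁-member : ∀ {i x} → i ≤ d → Layer⊆₁ i x → Layer i x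
  ⊆₁-member i≤d ⊆x = let t , t∈ = layer-inhabited w∈d _ i≤d in subst (Layer _) (⊆x t∈) t∈

  edges-into : ∀ {j x} → suc (suc j) ≤ d → Layer⊆₁ (suc (suc j)) x → Three (λ s → Layer (suc j) s × s ~ x)
  edges-into h ⊆x =
    Three-map proj₁ (λ (s∈ , q∈ , a) → s∈ , subst (_ ~_) (⊆x q∈) a)
      (λ (_ , q∈ , _) (_ , q′∈ , _) s≡s′ → ×-≡,≡→≡ (s≡s′ , trans (⊆x q∈) (sym (⊆x q′∈))))
      (layer-edges h)

  ¬sizes-2-*-1 : ∀ {j g g′ x} → suc (suc j) ≤ d → Layer⊆₂ j g g′ → Layer⊆₁ (suc (suc j)) x → ⊥
  ¬sizes-2-*-1 {j} h ⊆gg′ ⊆x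
    with collide proj₂ (λ (_ , r∈ , _) → ⊆gg′ r∈) (Three-extend (λ (s∈ , _) → parent s∈) (edges-into h ⊆x))
  ... | three ((_ , s₁x) , r∈ , rs₁) ((_ , s₂x) , _ , rs₂) _ e₁≢e₂ _ _ , refl =
    C4 (layers-disjoint r∈ (⊆₁-member h ⊆x) (i≢2+i j)) (λ s₁≡s₂ → e₁≢e₂ (cong (_, _) s₁≡s₂))
       rs₁ rs₂ (adj-flip s₁x) (adj-flip s₂x)

  ¬sizes-2-2-2 : ∀ {i p p′ a a′ b b′} → suc (suc i) ≤ d →
    Layer⊆₂ i p p′ → Layer⊆₂ (suc i) a a′ → Layer⊆₂ (suc (suc i)) b b′ → ⊥
  ¬sizes-2-2-2 {i} h ⊆pp′ ⊆aa′ ⊆bb′ with fan-down (≤-trans (n≤1+n _) h) ⊆pp′ | fan-up h ⊆bb′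
  ... | P , P∈ , two (s∈ , Ps) (s′∈ , Ps′) s≢s′ | B , B∈ , two (t∈ , tB) (t′∈ , t′B) t≢t′
    with In₂-other s≢s′ (⊆aa′ s∈) (⊆aa′ s′∈) (⊆aa′ t∈) | In₂-other s≢s′ (⊆aa′ s∈) (⊆aa′ s′∈) (⊆aa′ t′∈)
  ... | inj₁ refl | inj₁ refl = t≢t′ refl
  ... | inj₂ refl | inj₂ refl = t≢t′ refl
  ... | inj₁ refl | inj₂ refl = C4 (layers-disjoint P∈ B∈ (i≢2+i i)) s≢s′ Ps Ps′ (adj-flip tB) (adj-flip t′B)
  ... | inj₂ refl | inj₁ refl = C4 (layers-disjoint P∈ B∈ (i≢2+i i)) s≢s′ Ps Ps′ (adj-flip t′B) (adj-flip tB)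

  record Square (i : ℕ) : Set where
    field
      {α ᾱ β β̄} : Fin n
      α∈ : Layer i α
      ᾱ∈ : Layer i ᾱ
      β∈ : Layer (suc i) β
      β̄∈ : Layer (suc i) β̄
      α≢ᾱ : α ≢ ᾱ
      β≢β̄ : β ≢ β̄
      αβ : α ~ β
      αβ̄ : α ~ β̄
      ᾱβ : ᾱ ~ β
      ᾱ≁β̄ : ¬ ᾱ ~ β̄
      lower : Layer⊆₂ i α ᾱ
      upper : Layer⊆₂ (suc i) β β̄

  private
    square-from : ∀ {i a a′ b b′ α ᾱ β β̄} → Layer⊆₂ i a a′ → Layer⊆₂ (suc i) b b′ →
      Layer i α → Layer i ᾱ → Layer (suc i) β → Layer (suc i) β̄ →
      α ≢ ᾱ → β ≢ β̄ → α ~ β → α ~ β̄ → ᾱ ~ β → Square i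
    square-from ⊆aa′ ⊆bb′ α∈ ᾱ∈ β∈ β̄∈ α≢ᾱ β≢β̄ αβ αβ̄ ᾱβ = record
      { α∈ = α∈ ; ᾱ∈ = ᾱ∈ ; β∈ = β∈ ; β̄∈ = β̄∈ ; α≢ᾱ = α≢ᾱ ; β≢β̄ = β≢β̄ ; αβ = αβ ; αβ̄ = αβ̄ ; ᾱβ = ᾱβ
      ; ᾱ≁β̄ = C4 α≢ᾱ β≢β̄ αβ αβ̄ ᾱβ
      ; lower = λ x∈ → In₂-other α≢ᾱ (⊆aa′ α∈) (⊆aa′ ᾱ∈) (⊆aa′ x∈)
      ; upper = λ x∈ → In₂-other β≢β̄ (⊆bb′ β∈) (⊆bb′ β̄∈) (⊆bb′ x∈) }

  square : ∀ {i a a′ b b′} → suc i ≤ d → Layer⊆₂ i a a′ → Layer⊆₂ (suc i) b b′ → Square i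
  square h ⊆aa′ ⊆bb′ with collide proj₁ (λ (p∈ , _) → ⊆aa′ p∈) (layer-edges h)
  ... | three (P∈ , Q∈ , PQ) (_ , Q′∈ , PQ′) (p₃∈ , q₃∈ , p₃q₃) e₁≢e₂ e₁≢e₃ e₂≢e₃ , refl
    with In₂-other (λ e → e₁≢e₂ (cong (_ ,_) e)) (⊆bb′ Q∈) (⊆bb′ Q′∈) (⊆bb′ q₃∈)
  ... | inj₁ refl = square-from ⊆aa′ ⊆bb′ P∈ p₃∈ Q∈ Q′∈
                      (λ e → e₁≢e₃ (×-≡,≡→≡ (e , refl))) (λ e → e₁≢e₂ (cong (_ ,_) e)) PQ PQ′ p₃q₃
  ... | inj₂ refl = square-from ⊆aa′ ⊆bb′ P∈ p₃∈ Q′∈ Q∈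
                      (λ e → e₂≢e₃ (×-≡,≡→≡ (e , refl))) (λ e → e₁≢e₂ (cong (_ ,_) (sym e))) PQ′ PQ p₃q₃

  ¬sizes-2-2-at-end : ∀ {i a a′ b b′} → suc i ≡ d → Layer⊆₂ i a a′ → Layer⊆₂ (suc i) b b′ → ⊥
  ¬sizes-2-2-at-end 1+i≡d ⊆aa′ ⊆bb′ = last-square-impossible 1+i≡d (square (≤-reflexive 1+i≡d) ⊆aa′ ⊆bb′)
    where
    last-square-impossible : ∀ {i} → suc i ≡ d → Square i → ⊥
    last-square-impossible 1+i≡d sq = three-not-in-two (three-neighbours 2≤n β̄) neighbour∈αβ
      where
      open Square sq
      neighbour∈αβ : ∀ {t} → β̄ ~ t → In₂ t α β
      neighbour∈αβ β̄t with neighbour-layer β̄t β̄∈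
      ... | inj₁ t∈ with lower t∈
      ...   | inj₁ t≡α  = inj₁ t≡α
      ...   | inj₂ refl = ⊥-elim (ᾱ≁β̄ (adj-flip β̄t))
      neighbour∈αβ β̄t | inj₂ (inj₁ t∈) with upper t∈
      ...   | inj₁ t≡β  = inj₂ t≡β
      ...   | inj₂ refl = ⊥-elim (adj-≢ β̄t refl)
      neighbour∈αβ {t} β̄t | inj₂ (inj₂ t∈) =
        ⊥-elim (no-layer-beyond (subst (λ k → Layer (suc k) t) 1+i≡d t∈))

  record Prong (j : ℕ) (x : Fin n) : Set where
    field
      {tip root} : Fin n
      tip∈ : Layer (suc j) tip
      tip~x : tip ~ x
      root∈ : Layer j root
      root~tip : root ~ tip

  prong : ∀ {j x s} → Layer (suc j) s → s ~ x → Prong j x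
  prong s∈ sx =
    let r , r∈ , rs = parent s∈ in record { tip∈ = s∈ ; tip~x = sx ; root∈ = r∈ ; root~tip = rs }

  module _ {j x} (x∈ : Layer (suc (suc j)) x) where
    open Prong

    roots-differ : (P Q : Prong j x) → tip P ≢ tip Q → root P ≢ root Q
    roots-differ P Q tP≢tQ rP≡rQ =
      C4 (layers-disjoint (root∈ P) x∈ (i≢2+i j)) tP≢tQ
         (root~tip P) (subst (_~ tip Q) (sym rP≡rQ) (root~tip Q))
         (adj-flip (tip~x P)) (adj-flip (tip~x Q))

    sibling : ∀ {g₁ g₂ g₃} → Layer⊆₃ j g₁ g₂ g₃ → Layer⊆₁ (suc (suc j)) x → (P Q R : Prong j x) →
      tip P ≢ tip Q → tip P ≢ tip R → tip Q ≢ tip R → Σ (Fin n) λ z → Layer (suc j) z × tip P ~ z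
    sibling ⊆g ⊆x P Q R tP≢tQ tP≢tR tQ≢tR = one-other x (root P) classify (three-neighbours 2≤n (tip P))
      where
      not-other-root : ∀ {t} (S : Prong j x) → tip P ≢ tip S → tip P ~ t → t ≢ root S
      not-other-root S tP≢tS Pt refl =
        C4 (layers-disjoint (root∈ S) x∈ (i≢2+i j)) tP≢tS
           (adj-flip Pt) (root~tip S) (adj-flip (tip~x P)) (adj-flip (tip~x S))

      classify : ∀ {t} → tip P ~ t → In₂ t x (root P) ⊎ (Layer (suc j) t × tip P ~ t)
      classify {t} Pt with neighbour-layer Pt (tip∈ P)
      ... | inj₂ (inj₁ t∈) = inj₂ (t∈ , Pt)
      ... | inj₂ (inj₂ t∈) = inj₁ (inj₁ (⊆x t∈))
      ... | inj₁ t∈ with t ≟ root P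
      ...   | yes t≡r = inj₁ (inj₂ t≡r)
      ...   | no  t≢r = ⊥-elim (four-not-in-three (⊆g t∈) (⊆g (root∈ P)) (⊆g (root∈ Q)) (⊆g (root∈ R))
                          t≢r (not-other-root Q tP≢tQ Pt) (not-other-root R tP≢tR Pt)
                          (roots-differ P Q tP≢tQ) (roots-differ P R tP≢tR) (roots-differ Q R tQ≢tR))

  ¬sizes-3-3-1 : ∀ {j g₁ g₂ g₃ p₁ p₂ p₃ x} → suc (suc j) ≤ d →
    Layer⊆₃ j g₁ g₂ g₃ → Layer⊆₃ (suc j) p₁ p₂ p₃ → Layer⊆₁ (suc (suc j)) x → ⊥
  ¬sizes-3-3-1 {j} {x = x} h ⊆g ⊆p ⊆x = tips-impossible (edges-into h ⊆x)
    where
    x∈ : Layer (suc (suc j)) x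
    x∈ = ⊆₁-member h ⊆x

    hub : ∀ {a b c} → a ~ x → b ~ x → c ~ x → b ≢ c → a ~ b → a ~ c → ⊥
    hub ax bx cx b≢c ab ac = C4 (adj-≢ ax) b≢c ab ac (adj-flip bx) (adj-flip cx)

    tips-impossible : Three (λ s → Layer (suc j) s × s ~ x) → ⊥
    tips-impossible (three {s₁} {s₂} {s₃} (s₁∈ , s₁x) (s₂∈ , s₂x) (s₃∈ , s₃x) s₁≢s₂ s₁≢s₃ s₂≢s₃) =
      settle (neighbour-among P₁ P₂ P₃ s₁≢s₂ s₁≢s₃ s₂≢s₃)
             (neighbour-among P₂ P₁ P₃ (≢-sym s₁≢s₂) s₂≢s₃ s₁≢s₃)
             (neighbour-among P₃ P₁ P₂ (≢-sym s₁≢s₃) (≢-sym s₂≢s₃) s₁≢s₂)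
      where
      P₁ P₂ P₃ : Prong j x
      P₁ = prong s₁∈ s₁x
      P₂ = prong s₂∈ s₂x
      P₃ = prong s₃∈ s₃x

      neighbour-among : (P Q R : Prong j x) → Prong.tip P ≢ Prong.tip Q → Prong.tip P ≢ Prong.tip R →
        Prong.tip Q ≢ Prong.tip R → Σ (Fin n) λ z → In₃ z s₁ s₂ s₃ × Prong.tip P ~ z
      neighbour-among P Q R P≢Q P≢R Q≢R =
        let z , z∈ , Pz = sibling x∈ ⊆g ⊆x P Q R P≢Q P≢R Q≢R
        in z , In₃-other _≟_ (⊆p s₁∈) (⊆p s₂∈) (⊆p s₃∈) (⊆p z∈) s₁≢s₂ s₁≢s₃ s₂≢s₃ , Pz

      settle : Σ (Fin n) (λ z → In₃ z s₁ s₂ s₃ × s₁ ~ z) → Σ (Fin n) (λ z → In₃ z s₁ s₂ s₃ × s₂ ~ z) →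
               Σ (Fin n) (λ z → In₃ z s₁ s₂ s₃ × s₃ ~ z) → ⊥
      settle (_ , inj₁ refl , a) _ _ = adj-≢ a refl
      settle _ (_ , inj₂ (inj₁ refl) , b) _ = adj-≢ b refl
      settle _ _ (_ , inj₂ (inj₂ refl) , c) = adj-≢ c refl
      settle (_ , inj₂ (inj₁ refl) , a) _ (_ , inj₁ refl , c)        = hub s₁x s₂x s₃x s₂≢s₃ a (adj-flip c)
      settle (_ , inj₂ (inj₁ refl) , a) _ (_ , inj₂ (inj₁ refl) , c) = hub s₂x s₁x s₃x s₁≢s₃ (adj-flip a) (adj-flip c)
      settle (_ , inj₂ (inj₂ refl) , a) (_ , inj₁ refl , b) _        = hub s₁x s₂x s₃x s₂≢s₃ (adj-flip b) a
      settle (_ , inj₂ (inj₂ refl) , a) (_ , inj₂ (inj₂ refl) , b) _ = hub s₃x s₁x s₂x s₁≢s₂ (adj-flip a) (adj-flip b)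

  ball-plus : ℕ → Fin n → Fin n → Bool
  ball-plus k v x = ball u k x ∨ ball v zero x

  crossing-ball-plus : ∀ {k v p q} → Crossing G (ball-plus k v) (p , q) →
    q ≢ v × (Layer k p × Layer (suc k) q ⊎ p ≡ v × ball u k q ≡ false)
  crossing-ball-plus {k} {v} {p} {q} (p∈ , q∉ , pq) with ∨-false {ball u k q} q∉
  ... | q∉ball , q≢v with ∨-true {ball u k p} p∈
  ...   | inj₁ p∈ball = ball-zero-false v q q≢v , inj₁ (crossing-ball (p∈ball , q∉ball , pq))
  ...   | inj₂ p≡v    = ball-zero-false v q q≢v , inj₂ (ball-zero v p p≡v , q∉ball)

  ¬square-with-chord : ∀ {i y₁ y₂ y₃} (sq : Square i) → Square.α sq ~ Square.ᾱ sq →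
    Layer⊆₃ (suc (suc i)) y₁ y₂ y₃ → ⊥
  ¬square-with-chord {i} sq αᾱ ⊆y = too-many up-neighbours up-edges
    where
    open Square sq
    β≁β̄ : ¬ β ~ β̄
    β≁β̄ ββ̄ = C4 (layers-disjoint ᾱ∈ β̄∈ (i≢1+i i)) (layers-disjoint α∈ β∈ (i≢1+i i))
                (adj-flip αᾱ) ᾱβ (adj-flip αβ̄) (adj-flip ββ̄)

    up-neighbours : Two (λ t → Layer (suc (suc i)) t × β̄ ~ t)
    up-neighbours = two-others α classify (three-neighbours 2≤n β̄)
      where
      classify : ∀ {t} → β̄ ~ t → t ≡ α ⊎ Layer (suc (suc i)) t × β̄ ~ t
      classify β̄t with neighbour-layer β̄t β̄∈
      ... | inj₂ (inj₂ t∈) = inj₂ (t∈ , β̄t)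
      ... | inj₁ t∈ with lower t∈
      ...   | inj₁ t≡α  = inj₁ t≡α
      ...   | inj₂ refl = ⊥-elim (ᾱ≁β̄ (adj-flip β̄t))
      classify β̄t | inj₂ (inj₁ t∈) with upper t∈
      ...   | inj₁ refl = ⊥-elim (β≁β̄ (adj-flip β̄t))
      ...   | inj₂ refl = ⊥-elim (adj-≢ β̄t refl)

    up-edges : Two (λ (p , q) → p ≡ β × Layer (suc (suc i)) q × β ~ q)
    up-edges = two-others (α , β̄) classify (three-crossing-edges (ball-plus i β) u∈ β̄∉)
      where
      u∈ = ∨-introˡ (centre∈ball u i)
      β̄∉ = ∨-false-intro (layer⇒∉ball β̄∈ ≤-refl) (ball-zero-outside β β̄ (≢-sym β≢β̄))
      classify : ∀ {e} → Crossing G (ball-plus i β) e →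
                 e ≡ (α , β̄) ⊎ (proj₁ e ≡ β × Layer (suc (suc i)) (proj₂ e) × β ~ proj₂ e)
      classify c@(_ , _ , pq) with crossing-ball-plus c
      ... | q≢β , inj₁ (p∈ , q∈) with upper q∈
      ...   | inj₁ q≡β = ⊥-elim (q≢β q≡β)
      ...   | inj₂ refl with lower p∈
      ...     | inj₁ refl = inj₁ refl
      ...     | inj₂ refl = ⊥-elim (ᾱ≁β̄ pq)
      classify c@(_ , _ , pq) | q≢β , inj₂ (refl , q∉) with neighbour-layer pq β∈
      ...   | inj₁ q∈ = ⊥-elim (true≢false (layer⇒ball q∈) q∉)
      ...   | inj₂ (inj₂ q∈) = inj₂ (refl , q∈ , pq)
      ...   | inj₂ (inj₁ q∈) with upper q∈
      ...     | inj₁ q≡β = ⊥-elim (q≢β q≡β)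
      ...     | inj₂ refl = ⊥-elim (β≁β̄ pq)

    c≢e : ∀ {c e} → Layer (suc (suc i)) c → β̄ ~ c → β ~ e → c ≢ e
    c≢e c∈ β̄c βe refl = C4 β≢β̄ (layers-disjoint α∈ c∈ (i≢2+i i)) (adj-flip αβ) βe (adj-flip αβ̄) β̄c

    too-many : Two (λ t → Layer (suc (suc i)) t × β̄ ~ t) →
               Two (λ (p , q) → p ≡ β × Layer (suc (suc i)) q × β ~ q) → ⊥
    too-many (two (c₁∈ , β̄c₁) (c₂∈ , β̄c₂) c₁≢c₂) (two (refl , e₁∈ , βe₁) (refl , e₂∈ , βe₂) e₁≢e₂) =
      four-not-in-three (⊆y c₁∈) (⊆y c₂∈) (⊆y e₁∈) (⊆y e₂∈)
        c₁≢c₂ (c≢e c₁∈ β̄c₁ βe₁) (c≢e c₁∈ β̄c₁ βe₂) (c≢e c₂∈ β̄c₂ βe₁) (c≢e c₂∈ β̄c₂ βe₂)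
        (e₁≢e₂ ∘ cong (_ ,_))

  ¬square-without-chord : ∀ {j g₁ g₂ g₃} (sq : Square (suc j)) → ¬ Square.α sq ~ Square.ᾱ sq →
    Layer⊆₃ j g₁ g₂ g₃ → ⊥
  ¬square-without-chord {j} sq α≁ᾱ ⊆g = too-many down-neighbours down-edges
    where
    open Square sq

    down-neighbours : Two (λ t → Layer j t × ᾱ ~ t)
    down-neighbours = two-others β classify (three-neighbours 2≤n ᾱ)
      where
      classify : ∀ {t} → ᾱ ~ t → t ≡ β ⊎ Layer j t × ᾱ ~ t
      classify ᾱt with neighbour-layer ᾱt ᾱ∈
      ... | inj₁ t∈ = inj₂ (t∈ , ᾱt)
      ... | inj₂ (inj₁ t∈) with lower t∈
      ...   | inj₁ refl = ⊥-elim (α≁ᾱ (adj-flip ᾱt))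
      ...   | inj₂ refl = ⊥-elim (adj-≢ ᾱt refl)
      classify ᾱt | inj₂ (inj₂ t∈) with upper t∈
      ...   | inj₁ t≡β  = inj₁ t≡β
      ...   | inj₂ refl = ⊥-elim (ᾱ≁β̄ ᾱt)

    down-edges : Two (λ (p , q) → q ≡ α × Layer j p × p ~ α)
    down-edges = two-others (ᾱ , β) classify (three-crossing-edges (ball-plus j ᾱ) u∈ α∉)
      where
      u∈ = ∨-introˡ (centre∈ball u j)
      α∉ = ∨-false-intro (layer⇒∉ball α∈ ≤-refl) (ball-zero-outside ᾱ α α≢ᾱ)
      classify : ∀ {e} → Crossing G (ball-plus j ᾱ) e →
                 e ≡ (ᾱ , β) ⊎ (proj₂ e ≡ α × Layer j (proj₁ e) × proj₁ e ~ α)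
      classify c@(_ , _ , pq) with crossing-ball-plus c
      ... | q≢ᾱ , inj₁ (p∈ , q∈) with lower q∈
      ...   | inj₁ refl = inj₂ (refl , p∈ , pq)
      ...   | inj₂ q≡ᾱ  = ⊥-elim (q≢ᾱ q≡ᾱ)
      classify c@(_ , _ , pq) | q≢ᾱ , inj₂ (refl , q∉) with neighbour-layer pq ᾱ∈
      ...   | inj₁ q∈ = ⊥-elim (true≢false (layer⇒ball q∈) q∉)
      ...   | inj₂ (inj₁ q∈) with lower q∈
      ...     | inj₁ refl = ⊥-elim (α≁ᾱ (adj-flip pq))
      ...     | inj₂ q≡ᾱ  = ⊥-elim (q≢ᾱ q≡ᾱ)
      classify c@(_ , _ , pq) | q≢ᾱ , inj₂ (refl , q∉) | inj₂ (inj₂ q∈) with upper q∈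
      ...     | inj₁ refl = inj₁ refl
      ...     | inj₂ refl = ⊥-elim (ᾱ≁β̄ pq)

    c≢e : ∀ {c e} → Layer j c → ᾱ ~ c → e ~ α → c ≢ e
    c≢e c∈ ᾱc eα refl = C4 α≢ᾱ (layers-disjoint c∈ β∈ (i≢2+i j)) (adj-flip eα) αβ ᾱc ᾱβ

    too-many : Two (λ t → Layer j t × ᾱ ~ t) → Two (λ (p , q) → q ≡ α × Layer j p × p ~ α) → ⊥
    too-many (two (c₁∈ , ᾱc₁) (c₂∈ , ᾱc₂) c₁≢c₂) (two (refl , e₁∈ , e₁α) (refl , e₂∈ , e₂α) e₁≢e₂) =
      four-not-in-three (⊆g c₁∈) (⊆g c₂∈) (⊆g e₁∈) (⊆g e₂∈)
        c₁≢c₂ (c≢e c₁∈ ᾱc₁ e₁α) (c≢e c₁∈ ᾱc₁ e₂α) (c≢e c₂∈ ᾱc₂ e₁α) (c≢e c₂∈ ᾱc₂ e₂α)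
        (e₁≢e₂ ∘ cong (_, _))

  ¬sizes-3-2-2-3 : ∀ {j g₁ g₂ g₃ a a′ b b′ y₁ y₂ y₃} → suc (suc (suc j)) ≤ d →
    Layer⊆₃ j g₁ g₂ g₃ → Layer⊆₂ (suc j) a a′ → Layer⊆₂ (suc (suc j)) b b′ →
    Layer⊆₃ (suc (suc (suc j))) y₁ y₂ y₃ → ⊥
  ¬sizes-3-2-2-3 {j} h ⊆g ⊆aa′ ⊆bb′ ⊆y = by-chord (square (≤-trans (n≤1+n _) h) ⊆aa′ ⊆bb′)
    where
    by-chord : Square (suc j) → ⊥
    by-chord sq with adj G (Square.α sq) (Square.ᾱ sq) in αᾱ
    ... | true  = ¬square-with-chord sq αᾱ ⊆y
    ... | false = ¬square-without-chord sq (λ α~ᾱ → true≢false α~ᾱ αᾱ) ⊆g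

  layer-sizes-admissible : Admissible d size
  layer-sizes-admissible = record
    { sizes      = λ i i≤d → inhabited⇒size≥1 (proj₂ (layer-inhabited w∈d i i≤d)) , m⊓n≤n _ 4
    ; no-window₂ = window₂
    ; no-window₃ = window₃
    ; no-window₄ = λ i h (≤3 , ≤2 , ≤2′ , ≤3′) →
        let _ , _ , _ , ⊆g = size≤3 ≤3 ; _ , _ , ⊆a = size≤2 ≤2
            _ , _ , ⊆b = size≤2 ≤2′ ; _ , _ , _ , ⊆y = size≤3 ≤3′
        in ¬sizes-3-2-2-3 h ⊆g ⊆a ⊆b ⊆y
    ; no-end     = λ i 1+i≡d (≤2 , ≤2′) →
        let _ , _ , ⊆a = size≤2 ≤2 ; _ , _ , ⊆b = size≤2 ≤2′ in ¬sizes-2-2-at-end 1+i≡d ⊆a ⊆b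
    }
    where
    inhabited⇒size≥1 : ∀ {i x} → Layer i x → 1 ≤ size i
    inhabited⇒size≥1 x∈ = ⊓-glb (nonempty (∈members x∈)) (s≤s z≤n)
      where
      nonempty : ∀ {x : Fin n} {xs} → x ∈ xs → 1 ≤ length xs
      nonempty (here _)  = s≤s z≤n
      nonempty (there _) = s≤s z≤n

    window₂ : ∀ i → 1 + i ≤ d → ¬ Forbidden₂ (size i) (size (1 + i))
    window₂ i h (inj₁ (≤1 , ≤2)) = let _ , ⊆a = size≤1 ≤1 ; _ , _ , ⊆b = size≤2 ≤2 in ¬sizes-1-2 h ⊆a ⊆b
    window₂ i h (inj₂ (≤2 , ≤1)) = let _ , _ , ⊆a = size≤2 ≤2 ; _ , ⊆b = size≤1 ≤1 in ¬sizes-2-1 h ⊆a ⊆b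

    window₃ : ∀ i → 2 + i ≤ d → ¬ Forbidden₃ (size i) (size (1 + i)) (size (2 + i))
    window₃ i h (inj₁ (≤2 , ≤1)) = let _ , _ , ⊆a = size≤2 ≤2 ; _ , ⊆c = size≤1 ≤1 in ¬sizes-2-*-1 h ⊆a ⊆c
    window₃ i h (inj₂ (inj₁ (≤1 , ≤2))) = let _ , ⊆a = size≤1 ≤1 ; _ , _ , ⊆c = size≤2 ≤2 in ¬sizes-1-*-2 h ⊆a ⊆c
    window₃ i h (inj₂ (inj₂ (inj₁ (≤2 , ≤2′ , ≤2″)))) =
      let _ , _ , ⊆a = size≤2 ≤2 ; _ , _ , ⊆b = size≤2 ≤2′ ; _ , _ , ⊆c = size≤2 ≤2″ in ¬sizes-2-2-2 h ⊆a ⊆b ⊆c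
    window₃ i h (inj₂ (inj₂ (inj₂ (≤3 , ≤3′ , ≤1)))) =
      let _ , _ , _ , ⊆a = size≤3 ≤3 ; _ , _ , _ , ⊆b = size≤3 ≤3′ ; _ , ⊆c = size≤1 ≤1 in ¬sizes-3-3-1 h ⊆a ⊆b ⊆c

theorem1 : (n : ℕ) (G : Graph n) (d : ℕ) →
    Connected G → C4Free G → EdgeConnAtLeast3 G → IsDiameter G d →
    5 * d + 3 ≤ 2 * n
theorem1 n G d _ c4 (2≤n , ec) (within , u , w , far) = begin
  5 * d + 3                            ≤⟨ admissible-sum layer-sizes-admissible (eccentricity-positive 2≤n) ⟩
  2 * partialSum size d                ≤⟨ *-monoʳ-≤ 2 (partialSum-mono size≤length d) ⟩
  2 * partialSum (length ∘ members) d  ≤⟨ *-monoʳ-≤ 2 layer-sizes-total ⟩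
  2 * n                                ∎
  where
  open ≤-Reasoning
  open Ball (adj G)
  ecc : ∀ x → ball u d x ≡ true
  ecc x = let m , m≤d , walk = within u x in ball-mono u x m≤d (walk→ball walk)
  open Layers G u d ecc
  open SmallLayers G c4 ec 2≤n u d ecc (far⇒layer far)
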